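{- The function $\mathrm{Shove}:2^{\mathbb{N}}\to2^{\mathbb{N}}$, given by $\mathrm{Shove}(x)=\{n-\min(x)\mid n\in x\}$ for non-empty $x$ and $\mathrm{Shove}(\emptyset)=\emptyset$, is not $(\mathcal{U},\mathcal{P})$-definable.
   Context: $\mathbb{N}=\{0,1,2,\ldots\}$, $2^{\mathbb{N}}$ is its power set. A set-function is a map $(2^{\mathbb{N}})^k\to 2^{\mathbb{N}}$ for some $k\ge 0$. For a collection $\mathcal{O}$ of set-functions, $\mathcal{O}$-circuits are terms built from variables ranging over $2^{\mathbb{N}}$, the constants $\emptyset$, $\mathbb{N}$, $\{n\}$ ($n\in\mathbb{N}$), the operations $\cup$, $\cap$, complement relative to $\mathbb{N}$, and the functions in $\mathcal{O}$. A circuit with variables $x_1,\ldots,x_n$ ($n\ge1$) defines the function obtained by evaluation; a set-function is $\mathcal{O}$-definable if some $\mathcal{O}$-circuit defines it; "$(\mathcal{O}_1,\mathcal{O}_2)$-definable" means $(\mathcal{O}_1\cup\mathcal{O}_2)$-definable. For $s\subseteq\mathbb{N}$, $s_{|m}=s\cap\{0,\ldots,m\}$, componentwise on tuples. A set-function $G$ of arity $n$ is continuous at $\vec s$ if for every $m$ there is $n'$ such that for all $\vec t$, $\vec t_{|n'}=\vec s_{|n'}$ implies $G(\vec t)_{|m}=G(\vec s)_{|m}$. $\mathcal{U}$ is the collection of all set-functions (all arities) continuous everywhere; $\mathcal{P}$ is the collection of all set-functions (all arities) whose values all lie in $\{\emptyset,\{0\}\}$. -}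

module Defs where

open import Data.Nat using (ℕ; zero; suc; _+_; _≤_)
open import Data.Fin using (Fin; zero; suc)
open import Data.Product using (Σ; _×_; _,_)
open import Data.Sum using (_⊎_)
open import Data.Empty using (⊥)
open import Data.Unit using (⊤)
open import Relation.Nullary using (¬_)
open import Relation.Binary.PropositionalEquality using (_≡_)

Subset : Set₁
Subset = ℕ → Set

_⇔'_ : Set → Set → Set
A ⇔' B = (A → B) × (B → A)

_≃_ : Subset → Subset → Set
s ≃ t = ∀ n → s n ⇔' t n

SetFun : ℕ → Set₁
SetFun k = (Fin k → Subset) → Subset

Collection : Set₂
Collection = ∀ {k} → SetFun k → Set₁

_∪C_ : Collection → Collection → Collection
(O₁ ∪C O₂) G = O₁ G ⊎ O₂ G

AgreeUpTo : ∀ {k} → ℕ → (Fin k → Subset) → (Fin k → Subset) → Set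
AgreeUpTo m s t = ∀ j i → i ≤ m → (s j i ⇔' t j i)

ContinuousAt : ∀ {k} → SetFun k → (Fin k → Subset) → Set₁
ContinuousAt G s =
  ∀ m → Σ ℕ λ n' → ∀ t → AgreeUpTo n' t s →
    ∀ i → i ≤ m → (G t i ⇔' G s i)

𝒰 : Collection
𝒰 G = ∀ s → ContinuousAt G s

𝒫 : Collection
𝒫 G = ∀ s n → G s n → n ≡ 0

data Circuit (O : Collection) (n : ℕ) : Set₂ where
  var    : Fin n → Circuit O n
  empty  : Circuit O n
  full   : Circuit O n
  single : ℕ → Circuit O n
  union  : Circuit O n → Circuit O n → Circuit O n
  inter  : Circuit O n → Circuit O n → Circuit O n
  compl  : Circuit O n → Circuit O n
  app    : ∀ {k} (G : SetFun k) → O G → (Fin k → Circuit O n) → Circuit O n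

eval : ∀ {O : Collection} {n} → Circuit O n → (Fin n → Subset) → Subset
eval (var i) ρ = ρ i
eval empty ρ = λ _ → ⊥
eval full ρ = λ _ → ⊤
eval (single m) ρ = λ x → x ≡ m
eval (union c d) ρ = λ x → eval c ρ x ⊎ eval d ρ x
eval (inter c d) ρ = λ x → eval c ρ x × eval d ρ x
eval (compl c) ρ = λ x → ¬ eval c ρ x
eval (app G _ cs) ρ = G (λ i → eval (cs i) ρ)

Definable : (O : Collection) → ∀ {n} → SetFun (suc n) → Set₂
Definable O {n} F =
  Σ (Circuit O (suc n)) λ C → ∀ ρ → eval C ρ ≃ F ρ

IsMin : Subset → ℕ → Set
IsMin x m = x m × (∀ k → x k → m ≤ k)

-- Shove(x) = { n - min x | n ∈ x } for nonempty x, Shove(∅) = ∅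
Shove : Subset → Subset
Shove x n = Σ ℕ λ m → IsMin x m × x (n + m)

ShoveFun : SetFun 1
ShoveFun ρ = Shove (ρ zero)

module Submission where

-- Call Φ : (2^ℕ)^V → 2^ℕ *locally finite* at a point s if there is one
-- finite list W of sets such that, for every precision m, all inputs
-- close enough to s are sent m-close to some member of W.  (The choice
-- of member is only asserted up to double negation: the gates of 𝒫 leave
-- undecided whether their output is ∅ or {0}.)
--
-- Every circuit of (𝒰,𝒫) is locally finite at every point: continuous
-- functions are (with W a singleton), gates of 𝒫 are (with W = [{0}, ∅]),
-- and the property is preserved under composition with an everywhere
-- continuous set-function; union, intersection and complement are such.
--
-- Shove is not locally finite at ∅: if |W| = L, the L+1 inputs
-- {a, a+1+j} (j ≤ L, a large) are all close to ∅, yet their images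
-- {0, j+1} are pairwise distinct below L+1, so two of them would have
-- to share a member of W by the pigeonhole principle.

open import Defs
open import Relation.Nullary using (¬_; Dec; yes; no)

open import Data.Nat using (ℕ; zero; suc; _+_; _≤_; s≤s)
open import Data.Nat.Properties
  using (≤-refl; ≤-trans; m≤n+m; n<1+n; ≤⇒≯; <⇒≢; m≢1+n+m; +-cancelʳ-≡; suc-injective)
open import Data.Fin using (Fin; zero; suc; toℕ)
open import Data.Fin.Properties using (pigeonhole; toℕ≤pred[n]; ∀-cons; sequence)
import Data.Vec.Functional as Vector
open import Data.Product using (Σ; _×_; _,_; proj₁; proj₂)
open import Data.Sum using (_⊎_; inj₁; inj₂)
open import Data.Empty using (⊥; ⊥-elim)
open import Data.List using (List; []; _∷_; [_]; map; length; allFin; cartesianProductWith; lookup)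
open import Data.List.Extrema.Nat using (max; xs≤max)
open import Data.List.Membership.Propositional using (_∈_; find; lose)
open import Data.List.Membership.Propositional.Properties using (∈-map⁺; ∈-allFin)
open import Data.List.Relation.Unary.All as All using ()
open import Data.List.Relation.Unary.Any as Any using (Any; here; there; index)
open import Data.List.Relation.Unary.Any.Properties using (cartesianProductWith⁺; lookup-index)
open import Effect.Monad using (RawMonad)
open import Relation.Nullary.Negation using (¬¬-Monad; ¬¬-map)
open import Relation.Nullary.Decidable using (¬¬-excluded-middle)
open import Relation.Binary.PropositionalEquality using (_≡_; refl; sym; subst)

Inputs : ℕ → Set₁
Inputs V = Fin V → Subset

¬¬-sequence : ∀ {ℓ k} {P : Fin k → Set ℓ} → (∀ j → ¬ ¬ P j) → ¬ ¬ (∀ j → P j)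
¬¬-sequence = sequence (RawMonad.rawApplicative ¬¬-Monad)

⇔-refl : ∀ {A} → A ⇔' A
⇔-refl = (λ a → a) , (λ a → a)

⇔-sym : ∀ {A B} → A ⇔' B → B ⇔' A
⇔-sym (f , g) = g , f

⇔-trans : ∀ {A B C} → A ⇔' B → B ⇔' C → A ⇔' C
⇔-trans (f , g) (f' , g') = (λ a → f' (f a)) , (λ c → g (g' c))

_≈[_]_ : Subset → ℕ → Subset → Set
x ≈[ m ] y = ∀ i → i ≤ m → x i ⇔' y i

≈-refl : ∀ {x m} → x ≈[ m ] x
≈-refl i _ = ⇔-refl

≈-sym : ∀ {x y m} → x ≈[ m ] y → y ≈[ m ] x
≈-sym x≈y i i≤m = ⇔-sym (x≈y i i≤m)

≈-trans : ∀ {x y z m} → x ≈[ m ] y → y ≈[ m ] z → x ≈[ m ] z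
≈-trans x≈y y≈z i i≤m = ⇔-trans (x≈y i i≤m) (y≈z i i≤m)

≈-mono : ∀ {x y m n} → m ≤ n → x ≈[ n ] y → x ≈[ m ] y
≈-mono m≤n x≈y i i≤m = x≈y i (≤-trans i≤m m≤n)

agree-mono : ∀ {k m n} {s t : Inputs k} → m ≤ n → AgreeUpTo n s t → AgreeUpTo m s t
agree-mono m≤n a j = ≈-mono m≤n (a j)

≤-maxOf : ∀ {a} {A : Set a} (f : A → ℕ) {x : A} {xs : List A} →
          x ∈ xs → f x ≤ max 0 (map f xs)
≤-maxOf f x∈xs = All.lookup (xs≤max 0 (map f _)) (∈-map⁺ f x∈xs)

combos : ∀ {a} {A : Set a} {k} → (Fin k → List A) → List (Fin k → A)
combos {k = zero}  W = [ (λ ()) ]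
combos {k = suc k} W = cartesianProductWith Vector._∷_ (W zero) (combos (λ j → W (suc j)))

combos⁺ : ∀ {a p} {A : Set a} {k} {W : Fin k → List A} {P : Fin k → A → Set p} →
          (∀ j → Any (P j) (W j)) → Any (λ w → ∀ j → P j (w j)) (combos W)
combos⁺ {k = zero}  _  = here (λ ())
combos⁺ {k = suc k} hs =
  cartesianProductWith⁺ Vector._∷_ ∀-cons (hs zero) (combos⁺ (λ j → hs (suc j)))

LocallyFinite : ∀ {V} → (Inputs V → Subset) → Inputs V → Set₁
LocallyFinite Φ s = Σ (List Subset) λ W → ∀ m → Σ ℕ λ N →
  ∀ t → AgreeUpTo N t s → ¬ ¬ Any (λ w → Φ t ≈[ m ] w) W

LF-resp-≃ : ∀ {V} {Φ Ψ : Inputs V → Subset} {s} →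
            (∀ t → Φ t ≃ Ψ t) → LocallyFinite Φ s → LocallyFinite Ψ s
LF-resp-≃ Φ≃Ψ (W , modulus) = W , λ m →
  let N , close = modulus m in
  N , λ t a → ¬¬-map (Any.map (≈-trans (λ i _ → ⇔-sym (Φ≃Ψ t i)))) (close t a)

continuous-LF : ∀ {V} {Φ : Inputs V → Subset} {s} → ContinuousAt Φ s → LocallyFinite Φ s
continuous-LF {Φ = Φ} {s} c = [ Φ s ] , λ m → let N , close = c m in N , λ t a ¬near → ¬near (here (close t a))

below-one-LF : ∀ {V} {Φ : Inputs V → Subset} {s} →
               (∀ t n → Φ t n → n ≡ 0) → LocallyFinite Φ s
below-one-LF {Φ = Φ} Φ⊆0 = W , λ m → 0 , λ t _ → ¬¬-map (behaviour t) ¬¬-excluded-middle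
  where
  W : List Subset
  W = (λ n → n ≡ 0) ∷ (λ _ → ⊥) ∷ []

  behaviour : ∀ {m} t → Dec (Φ t 0) → Any (λ w → Φ t ≈[ m ] w) W
  behaviour t (yes Φt0) = here λ i _ → Φ⊆0 t i , λ i≡0 → subst (Φ t) (sym i≡0) Φt0
  behaviour t (no ¬Φt0) = there (here λ i _ → (λ Φti → ¬Φt0 (subst (Φ t) (Φ⊆0 t i Φti) Φti)) , λ ())

-- The behaviours are the G-images of all combinations of behaviours; for
-- precision m the arguments must be matched up to the largest modulus of
-- continuity of G at these (finitely many) combinations.
compose-LF : ∀ {k V} {s : Inputs V} (G : SetFun k) → 𝒰 G → (F : Fin k → Inputs V → Subset) →
             (∀ j → LocallyFinite (F j) s) → LocallyFinite (λ t → G (λ j → F j t)) s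
compose-LF {k} {s = s} G G-cont F lf = map G (combos W) , modulus
  where
  W : Fin k → List Subset
  W j = proj₁ (lf j)

  modulus : ∀ m → Σ ℕ λ N → ∀ t → AgreeUpTo N t s →
            ¬ ¬ Any (λ w → G (λ j → F j t) ≈[ m ] w) (map G (combos W))
  modulus m = N , close
    where
    nG : Inputs k → ℕ
    nG w = proj₁ (G-cont w m)
    m' : ℕ
    m' = max 0 (map nG (combos W))
    N : ℕ
    N = max 0 (map (λ j → proj₁ (proj₂ (lf j) m')) (allFin k))

    near-G : ∀ t → (∀ j → Any (λ w → F j t ≈[ m' ] w) (W j)) →
             Any (λ w → G (λ j → F j t) ≈[ m ] w) (map G (combos W))
    near-G t near with find (combos⁺ near)
    ... | w , w∈ , Ft≈w =
      lose (∈-map⁺ G w∈) (proj₂ (G-cont w m) _ (λ j → ≈-mono (≤-maxOf nG w∈) (Ft≈w j)))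

    close : ∀ t → AgreeUpTo N t s → ¬ ¬ Any (λ w → G (λ j → F j t) ≈[ m ] w) (map G (combos W))
    close t a = ¬¬-map (near-G t) (¬¬-sequence λ j →
      proj₂ (proj₂ (lf j) m') t (agree-mono (≤-maxOf _ (∈-allFin j)) a))

Pointwise : ∀ {k} → SetFun k → Set₁
Pointwise G = ∀ s t n → (∀ j → s j n ⇔' t j n) → G s n ⇔' G t n

pointwise⇒𝒰 : ∀ {k} {G : SetFun k} → Pointwise G → 𝒰 G
pointwise⇒𝒰 pw s m = m , λ t a i i≤m → pw t s i (λ j → a j i i≤m)

∪-fun ∩-fun : SetFun 2
∪-fun x n = x zero n ⊎ x (suc zero) n
∩-fun x n = x zero n × x (suc zero) n

∁-fun : SetFun 1
∁-fun x n = ¬ x zero n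

∪-pointwise : Pointwise ∪-fun
∪-pointwise _ _ _ e with e zero | e (suc zero)
... | f , g | f' , g' = (λ { (inj₁ x) → inj₁ (f x) ; (inj₂ y) → inj₂ (f' y) })
                      , (λ { (inj₁ x) → inj₁ (g x) ; (inj₂ y) → inj₂ (g' y) })

∩-pointwise : Pointwise ∩-fun
∩-pointwise _ _ _ e with e zero | e (suc zero)
... | f , g | f' , g' = (λ { (x , y) → f x , f' y }) , (λ { (x , y) → g x , g' y })

∁-pointwise : Pointwise ∁-fun
∁-pointwise _ _ _ e with e zero
... | f , g = (λ ¬x y → ¬x (g y)) , (λ ¬y x → ¬y (f x))

circuit-LF : ∀ {V} (C : Circuit (𝒰 ∪C 𝒫) V) s → LocallyFinite (eval C) s
circuit-LF (var j)    s = continuous-LF λ m → m , λ t a → a j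
circuit-LF empty      s = continuous-LF λ _ → 0 , λ _ _ → ≈-refl
circuit-LF full       s = continuous-LF λ _ → 0 , λ _ _ → ≈-refl
circuit-LF (single n) s = continuous-LF λ _ → 0 , λ _ _ → ≈-refl
circuit-LF (union c d) s =
  compose-LF ∪-fun (pointwise⇒𝒰 ∪-pointwise) (λ { zero → eval c ; (suc zero) → eval d })
    λ { zero → circuit-LF c s ; (suc zero) → circuit-LF d s }
circuit-LF (inter c d) s =
  compose-LF ∩-fun (pointwise⇒𝒰 ∩-pointwise) (λ { zero → eval c ; (suc zero) → eval d })
    λ { zero → circuit-LF c s ; (suc zero) → circuit-LF d s }
circuit-LF (compl c) s =
  compose-LF ∁-fun (pointwise⇒𝒰 ∁-pointwise) (λ _ → eval c) (λ _ → circuit-LF c s)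
circuit-LF (app G (inj₁ G∈𝒰) cs) s =
  compose-LF G G∈𝒰 (λ j → eval (cs j)) (λ j → circuit-LF (cs j) s)
circuit-LF (app G (inj₂ G∈𝒫) cs) s =
  below-one-LF (λ t → G∈𝒫 (λ j → eval (cs j) t))

∅ : Subset
∅ _ = ⊥

probe : ℕ → ℕ → Subset
probe a j n = n ≡ a ⊎ n ≡ suc j + a

shove-probe : ∀ a j → Shove (probe a j) (suc j)
shove-probe a j = a , (inj₁ refl , a-least) , inj₂ refl
  where
  a-least : ∀ k → probe a j k → a ≤ k
  a-least _ (inj₁ refl) = ≤-refl
  a-least _ (inj₂ refl) = m≤n+m a (suc j)

-- Conversely, i+1 ∈ Shove(probe a j) forces i = j: the minimum must be a.
shove-probe⁻¹ : ∀ a i j → Shove (probe a j) (suc i) → i ≡ j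
shove-probe⁻¹ a i j (_ , (inj₂ refl , least) , _) = ⊥-elim (≤⇒≯ (m≤n+m a j) (least a (inj₁ refl)))
shove-probe⁻¹ a i j (_ , (inj₁ refl , _) , inj₁ eq) = ⊥-elim (m≢1+n+m a (sym eq))
shove-probe⁻¹ a i j (_ , (inj₁ refl , _) , inj₂ eq) = suc-injective (+-cancelʳ-≡ a (suc i) (suc j) eq)

probe-near-∅ : ∀ N j → probe (suc N) j ≈[ N ] ∅
probe-near-∅ N j i i≤N = (λ { (inj₁ refl) → ≤⇒≯ i≤N ≤-refl
                            ; (inj₂ refl) → ≤⇒≯ i≤N (m≤n+m (suc N) (suc j)) })
                       , λ ()

same-behaviour : ∀ {x y m} {W : List Subset} (p : Any (λ w → x ≈[ m ] w) W)
                 (q : Any (λ w → y ≈[ m ] w) W) → index p ≡ index q → x ≈[ m ] y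
same-behaviour {W = W} p q p≡q =
  ≈-trans (lookup-index p) (≈-sym (subst (λ k → _ ≈[ _ ] lookup W k) (sym p≡q) (lookup-index q)))

-- Picking behaviours for the L+1 probes (L = |W|), two probes i < j share one;
-- then i+1 ∈ Shove(probe i) transfers to Shove(probe j), whence i = j.
shove-not-LF : ¬ LocallyFinite ShoveFun (λ _ → ∅)
shove-not-LF (W , modulus) = ¬¬-sequence near collision
  where
  L : ℕ
  L = length W
  N : ℕ
  N = proj₁ (modulus (suc L))

  input : Fin (suc L) → Inputs 1
  input j _ = probe (suc N) (toℕ j)

  near : ∀ j → ¬ ¬ Any (λ w → ShoveFun (input j) ≈[ suc L ] w) W
  near j = proj₂ (modulus (suc L)) (input j) (λ _ → probe-near-∅ N (toℕ j))

  collision : (∀ j → Any (λ w → ShoveFun (input j) ≈[ suc L ] w) W) → ⊥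
  collision chosen with pigeonhole (n<1+n L) (λ j → index (chosen j))
  ... | i , j , i<j , same = <⇒≢ i<j (shove-probe⁻¹ (suc N) (toℕ i) (toℕ j) i+1∈Shove[j])
    where
    i+1∈Shove[j] : Shove (probe (suc N) (toℕ j)) (suc (toℕ i))
    i+1∈Shove[j] = proj₁ (same-behaviour (chosen i) (chosen j) same (suc (toℕ i)) (s≤s (toℕ≤pred[n] i)))
                         (shove-probe (suc N) (toℕ i))

theorem5 : ¬ Definable (𝒰 ∪C 𝒫) ShoveFun
theorem5 (C , eval≃Shove) = shove-not-LF (LF-resp-≃ eval≃Shove (circuit-LF C (λ _ → ∅)))
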